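{- Let $R$ be a commutative ring with unity and suppose the edge-labeled graph $(G,\alpha)$ over $R$ has rank one. Then for every vertex $v$ of $G$, the intersection of the ideals $\alpha(e)$ over all edges $e$ incident to $v$ is $(0)$.
   Context: An edge labeling of a graph $G=(V,E)$ over $R$ is a function $\alpha:E\to I(R)$ to the set of ideals of $R$. A spline on $(G,\alpha)$ is a function $p:V\to R$ with $p(u)-p(w)\in\alpha(uw)$ for every edge $uw$. A constant spline takes the same value at every vertex. $(G,\alpha)$ has rank one if it admits only constant splines. -}

module Defs where

open import Level using (Level; _⊔_; suc)
open import Algebra.Bundles using (CommutativeRing)
open import Data.Nat using (ℕ)
open import Data.Fin using (Fin)
open import Data.Product using (_×_)
open import Data.Sum using (_⊎_)
open import Relation.Binary.PropositionalEquality using (_≡_; _≢_)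

record Ideal {c ℓ} (R : CommutativeRing c ℓ) (ℓi : Level) : Set (c ⊔ ℓ ⊔ suc ℓi) where
  open CommutativeRing R
  field
    _∈I    : Carrier → Set ℓi
    resp   : ∀ {x y} → x ≈ y → x ∈I → y ∈I
    0∈     : 0# ∈I
    +-closed : ∀ {x y} → x ∈I → y ∈I → (x + y) ∈I
    -‿closed : ∀ {x} → x ∈I → (- x) ∈I
    *-closed : ∀ r {x} → x ∈I → (r * x) ∈I

open Ideal public

record Graph (n : ℕ) : Set₁ where
  field
    Edge   : Set
    end₁   : Edge → Fin n
    end₂   : Edge → Fin n
    loopless : ∀ e → end₁ e ≢ end₂ e
    simple : ∀ e e' →
             ((end₁ e ≡ end₁ e' × end₂ e ≡ end₂ e') ⊎
              (end₁ e ≡ end₂ e' × end₂ e ≡ end₁ e')) → e ≡ e'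

open Graph public

Incident : ∀ {n} (G : Graph n) → Edge G → Fin n → Set
Incident G e v = (end₁ G e ≡ v) ⊎ (end₂ G e ≡ v)

EdgeLabeling : ∀ {c ℓ} (R : CommutativeRing c ℓ) (ℓi : Level) {n} → Graph n → Set (c ⊔ ℓ ⊔ suc ℓi)
EdgeLabeling R ℓi G = Edge G → Ideal R ℓi

IsSpline : ∀ {c ℓ ℓi} (R : CommutativeRing c ℓ) {n} (G : Graph n)
           (α : EdgeLabeling R ℓi G) → (Fin n → CommutativeRing.Carrier R) → Set ℓi
IsSpline R G α p = ∀ e → (α e ∈I) (p (end₁ G e) - p (end₂ G e))
  where open CommutativeRing R

IsConstant : ∀ {c ℓ} (R : CommutativeRing c ℓ) {n} → (Fin n → CommutativeRing.Carrier R) → Set ℓ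
IsConstant R p = ∀ u w → p u ≈ p w
  where open CommutativeRing R

RankOne : ∀ {c ℓ ℓi} (R : CommutativeRing c ℓ) {n} (G : Graph n)
          (α : EdgeLabeling R ℓi G) → Set (c ⊔ ℓ ⊔ ℓi)
RankOne R G α = ∀ p → IsSpline R G α p → IsConstant R p

InIncidentIntersection : ∀ {c ℓ ℓi} (R : CommutativeRing c ℓ) {n} (G : Graph n)
                         (α : EdgeLabeling R ℓi G) → Fin n → CommutativeRing.Carrier R → Set ℓi
InIncidentIntersection R G α v x = ∀ e → Incident G e v → (α e ∈I) x

-- If x lies in the label of every edge at v, the function that is x at v and 0 elsewhere is
-- a spline. Rank one makes it constant, and comparing its value at v with its value at any
-- other vertex gives x = 0. The converse holds because every ideal contains 0.
module Submission where

open import Defs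
open import Level using (Level)
open import Algebra.Bundles using (CommutativeRing)
open import Data.Nat using (ℕ; _≤_; s≤s)
open import Data.Fin using (Fin; zero; _≟_; punchIn)
open import Data.Fin.Properties using (punchInᵢ≢i)
open import Data.Product using (_×_; _,_; ∃)
open import Data.Sum using (inj₁; inj₂)
open import Relation.Nullary using (yes; no; contradiction)
open import Relation.Binary.PropositionalEquality using (_≢_; refl; trans; sym)

∃-distinct : ∀ {n} → 2 ≤ n → (v : Fin n) → ∃ λ w → w ≢ v
∃-distinct (s≤s (s≤s _)) v = punchIn v zero , punchInᵢ≢i v zero

module _ {c ℓ} (R : CommutativeRing c ℓ) where
  open CommutativeRing R
    renaming (refl to ≈-refl; trans to ≈-trans; sym to ≈-sym)
  open import Algebra.Properties.Ring ring using (-0#≈0#)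

  x-0#≈x : ∀ x → x - 0# ≈ x
  x-0#≈x x = ≈-trans (+-congˡ -0#≈0#) (+-identityʳ x)

  ≈0#⇒∈ : ∀ {ℓi} (I : Ideal R ℓi) {x} → x ≈ 0# → (I ∈I) x
  ≈0#⇒∈ I x≈0 = resp I (≈-sym x≈0) (0∈ I)

  bump : ∀ {n} → Fin n → Carrier → Fin n → Carrier
  bump v x u with u ≟ v
  ... | yes _ = x
  ... | no  _ = 0#

  bump-at : ∀ {n} (v : Fin n) x → bump v x v ≈ x
  bump-at v x with v ≟ v
  ... | yes _   = ≈-refl
  ... | no  v≢v = contradiction refl v≢v

  bump-off : ∀ {n} {u v : Fin n} x → u ≢ v → bump v x u ≈ 0#
  bump-off {u = u} {v} x u≢v with u ≟ v
  ... | yes u≡v = contradiction u≡v u≢v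
  ... | no  _   = ≈-refl

  bump-isSpline : ∀ {ℓi n} (G : Graph n) (α : EdgeLabeling R ℓi G) v x →
                  InIncidentIntersection R G α v x → IsSpline R G α (bump v x)
  bump-isSpline G α v x x∈∩ e with end₁ G e ≟ v | end₂ G e ≟ v
  ... | yes a | yes b = contradiction (trans a (sym b)) (loopless G e)
  ... | yes a | no  _ = resp (α e) (≈-sym (x-0#≈x x)) (x∈∩ e (inj₁ a))
  ... | no  _ | yes b = resp (α e) (≈-sym (+-identityˡ (- x))) (-‿closed (α e) (x∈∩ e (inj₂ b)))
  ... | no  _ | no  _ = ≈0#⇒∈ (α e) (x-0#≈x 0#)

lemma4p4 : ∀ {c ℓ ℓi : Level} (R : CommutativeRing c ℓ) {n : ℕ} → 2 ≤ n →
           (G : Graph n) (α : EdgeLabeling R ℓi G) → RankOne R G α →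
           (v : Fin n) (x : CommutativeRing.Carrier R) →
           (InIncidentIntersection R G α v x → CommutativeRing._≈_ R x (CommutativeRing.0# R))
           × (CommutativeRing._≈_ R x (CommutativeRing.0# R) → InIncidentIntersection R G α v x)
lemma4p4 R 2≤n G α rankOne v x = ∈∩⇒≈0# , (λ x≈0 e _ → ≈0#⇒∈ R (α e) x≈0)
  where
  open CommutativeRing R using (_≈_; 0#; setoid)
  open import Relation.Binary.Reasoning.Setoid setoid

  ∈∩⇒≈0# : InIncidentIntersection R G α v x → x ≈ 0#
  ∈∩⇒≈0# x∈∩ with ∃-distinct 2≤n v
  ... | w , w≢v = begin
    x            ≈⟨ bump-at R v x ⟨
    bump R v x v ≈⟨ rankOne (bump R v x) (bump-isSpline R G α v x x∈∩) v w ⟩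
    bump R v x w ≈⟨ bump-off R x w≢v ⟩
    0#           ∎
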